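{- Let $\mathcal{C}$ and $\mathcal{D}$ be categories with binary coproducts, $F\colon\mathcal{C}\to\mathcal{D}$ left adjoint to $G\colon\mathcal{D}\to\mathcal{C}$, $H$ an endofunctor on $\mathcal{C}$, $L$ an endofunctor on $\mathcal{D}$, and $\rho\colon HG\Rightarrow GL$ a natural transformation. If $\zeta\colon\Theta\xrightarrow{\cong}L(\Theta)$ is a final $L$-coalgebra, then the $H$-algebra $G(\zeta^{ -1})\circ\rho_\Theta\colon HG(\Theta)\to G(\Theta)$ is completely iterative.
   Context: For an endofunctor $K$ on a category with binary coproducts, a $K$-algebra $a\colon K(Y)\to Y$ is completely iterative if for every map $c\colon X\to Y+K(X)$ there is a unique $f\colon X\to Y$ with $f=[\mathrm{id}_Y,a]\circ(Y+K(f))\circ c$. -}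

module Defs where

open import Level using (Level; _⊔_; suc)
open import Data.Product using (Σ; _×_; _,_)
open import Relation.Binary using (IsEquivalence)

record Category (o ℓ e : Level) : Set (suc (o ⊔ ℓ ⊔ e)) where
  infixr 9 _∘_
  infix  4 _≈_ _⇒_
  field
    Obj   : Set o
    _⇒_   : Obj → Obj → Set ℓ
    _≈_   : ∀ {A B} → A ⇒ B → A ⇒ B → Set e
    id    : ∀ {A} → A ⇒ A
    _∘_   : ∀ {A B C} → B ⇒ C → A ⇒ B → A ⇒ C
    equiv : ∀ {A B} → IsEquivalence (_≈_ {A} {B})
    ∘-resp-≈ : ∀ {A B C} {f h : B ⇒ C} {g i : A ⇒ B} → f ≈ h → g ≈ i → f ∘ g ≈ h ∘ i
    identityˡ : ∀ {A B} {f : A ⇒ B} → id ∘ f ≈ f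
    identityʳ : ∀ {A B} {f : A ⇒ B} → f ∘ id ≈ f
    assoc : ∀ {A B C D} {f : A ⇒ B} {g : B ⇒ C} {h : C ⇒ D} → (h ∘ g) ∘ f ≈ h ∘ (g ∘ f)

record BinaryCoproducts {o ℓ e} (C : Category o ℓ e) : Set (o ⊔ ℓ ⊔ e) where
  open Category C
  infixr 6 _+_
  field
    _+_  : Obj → Obj → Obj
    i₁   : ∀ {A B} → A ⇒ A + B
    i₂   : ∀ {A B} → B ⇒ A + B
    [_,_] : ∀ {A B X} → A ⇒ X → B ⇒ X → A + B ⇒ X
    inject₁ : ∀ {A B X} {f : A ⇒ X} {g : B ⇒ X} → [ f , g ] ∘ i₁ ≈ f
    inject₂ : ∀ {A B X} {f : A ⇒ X} {g : B ⇒ X} → [ f , g ] ∘ i₂ ≈ g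
    unique  : ∀ {A B X} {f : A ⇒ X} {g : B ⇒ X} {h : A + B ⇒ X} →
              h ∘ i₁ ≈ f → h ∘ i₂ ≈ g → [ f , g ] ≈ h

  _+₁_ : ∀ {A B A′ B′} → A ⇒ A′ → B ⇒ B′ → A + B ⇒ A′ + B′
  f +₁ g = [ i₁ ∘ f , i₂ ∘ g ]

record Functor {o ℓ e o′ ℓ′ e′} (C : Category o ℓ e) (D : Category o′ ℓ′ e′)
       : Set (o ⊔ ℓ ⊔ e ⊔ o′ ⊔ ℓ′ ⊔ e′) where
  private
    module C = Category C
    module D = Category D
  field
    F₀ : C.Obj → D.Obj
    F₁ : ∀ {A B} → A C.⇒ B → F₀ A D.⇒ F₀ B
    identity : ∀ {A} → F₁ (C.id {A}) D.≈ D.id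
    homomorphism : ∀ {X Y Z} {f : X C.⇒ Y} {g : Y C.⇒ Z} →
                   F₁ (g C.∘ f) D.≈ F₁ g D.∘ F₁ f
    F-resp-≈ : ∀ {A B} {f g : A C.⇒ B} → f C.≈ g → F₁ f D.≈ F₁ g

Endofunctor : ∀ {o ℓ e} → Category o ℓ e → Set (o ⊔ ℓ ⊔ e)
Endofunctor C = Functor C C

_∘F_ : ∀ {o ℓ e o′ ℓ′ e′ o″ ℓ″ e″} {C : Category o ℓ e} {D : Category o′ ℓ′ e′}
         {E : Category o″ ℓ″ e″} → Functor D E → Functor C D → Functor C E
_∘F_ {C = C} {D} {E} G F = record
  { F₀ = λ X → G.F₀ (F.F₀ X)
  ; F₁ = λ f → G.F₁ (F.F₁ f)
  ; identity = E.trans (G.F-resp-≈ F.identity) G.identity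
  ; homomorphism = E.trans (G.F-resp-≈ F.homomorphism) G.homomorphism
  ; F-resp-≈ = λ p → G.F-resp-≈ (F.F-resp-≈ p)
  }
  where
    module F = Functor F
    module G = Functor G
    module E where
      open Category E public
      trans : ∀ {A B} {f g h : A ⇒ B} → f ≈ g → g ≈ h → f ≈ h
      trans = IsEquivalence.trans equiv

record NaturalTransformation {o ℓ e o′ ℓ′ e′} {C : Category o ℓ e} {D : Category o′ ℓ′ e′}
       (F G : Functor C D) : Set (o ⊔ ℓ ⊔ e ⊔ o′ ⊔ ℓ′ ⊔ e′) where
  private
    module C = Category C
    module D = Category D
    module F = Functor F
    module G = Functor G
  field
    η : ∀ X → F.F₀ X D.⇒ G.F₀ X
    commute : ∀ {X Y} (f : X C.⇒ Y) → η Y D.∘ F.F₁ f D.≈ G.F₁ f D.∘ η X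

idF : ∀ {o ℓ e} {C : Category o ℓ e} → Functor C C
idF {C = C} = record
  { F₀ = λ X → X
  ; F₁ = λ f → f
  ; identity = IsEquivalence.refl equiv
  ; homomorphism = IsEquivalence.refl equiv
  ; F-resp-≈ = λ p → p
  }
  where open Category C

record Adjunction {o ℓ e o′ ℓ′ e′} {C : Category o ℓ e} {D : Category o′ ℓ′ e′}
       (F : Functor C D) (G : Functor D C) : Set (o ⊔ ℓ ⊔ e ⊔ o′ ⊔ ℓ′ ⊔ e′) where
  private
    module C = Category C
    module D = Category D
    module F = Functor F
    module G = Functor G
  field
    unit   : NaturalTransformation idF (G ∘F F)
    counit : NaturalTransformation (F ∘F G) idF
  private
    module unit = NaturalTransformation unit
    module counit = NaturalTransformation counit
  field
    zig : ∀ {A} → counit.η (F.F₀ A) D.∘ F.F₁ (unit.η A) D.≈ D.id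
    zag : ∀ {B} → G.F₁ (counit.η B) C.∘ unit.η (G.F₀ B) C.≈ C.id

record Iso {o ℓ e} (C : Category o ℓ e) (A B : Category.Obj C) : Set (ℓ ⊔ e) where
  open Category C
  field
    from : A ⇒ B
    to   : B ⇒ A
    isoˡ : to ∘ from ≈ id
    isoʳ : from ∘ to ≈ id

∃!≈ : ∀ {o ℓ e} (C : Category o ℓ e) {A B : Category.Obj C} →
      (P : Category._⇒_ C A B → Set e) → Set (ℓ ⊔ e)
∃!≈ C {A} {B} P = Σ (A ⇒ B) (λ f → P f × (∀ g → P g → g ≈ f))
  where open Category C

IsFinalCoalgebra : ∀ {o ℓ e} (D : Category o ℓ e) (L : Endofunctor D)
                   (Θ : Category.Obj D) → Category._⇒_ D Θ (Functor.F₀ L Θ) → Set (o ⊔ ℓ ⊔ e)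
IsFinalCoalgebra D L Θ ζ =
  ∀ {X} (c : X ⇒ L.F₀ X) → ∃!≈ D (λ h → ζ ∘ h ≈ L.F₁ h ∘ c)
  where
    open Category D
    module L = Functor L

IsCompletelyIterative : ∀ {o ℓ e} (C : Category o ℓ e) (CP : BinaryCoproducts C)
                        (K : Endofunctor C) (Y : Category.Obj C) →
                        Category._⇒_ C (Functor.F₀ K Y) Y → Set (o ⊔ ℓ ⊔ e)
IsCompletelyIterative C CP K Y a =
  ∀ {X} (c : X ⇒ Y + K.F₀ X) →
    ∃!≈ C (λ f → f ≈ [ id , a ] ∘ (id +₁ K.F₁ f) ∘ c)
  where
    open Category C
    open BinaryCoproducts CP
    module K = Functor K

-- Fix c : X → GΘ + HX and consider the L-coalgebra on Θ + FX which is ζ on Θ and, on FX,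
-- the adjoint transpose of the map X → GL(Θ + FX) read off from c (through ρ and the unit on
-- the H-summand).  A map m : Θ + FX → Θ that is the identity on Θ corresponds, via the
-- transpose of m ∘ i₂, to a map X → GΘ, and m is a coalgebra homomorphism exactly when that
-- map solves the iteration equation of c.  The unique homomorphism into the final coalgebra
-- is the identity on Θ (its restriction there is an endomorphism of ζ), so the iteration
-- equation has exactly one solution.
module Submission where

open import Defs
open import Data.Product using (_,_; proj₁; proj₂)
open import Function.Bundles using (_⇔_; mk⇔; module Equivalence)
open import Relation.Binary.Bundles using (Setoid)
import Relation.Binary.Reasoning.Setoid as SetoidReasoning

module HomReasoning {o ℓ e} (C : Category o ℓ e) where
  open Category C

  hom-setoid : Obj → Obj → Setoid ℓ e
  hom-setoid A B = record { Carrier = A ⇒ B ; _≈_ = _≈_ ; isEquivalence = equiv }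

  open module HomSetoid {A B} = Setoid (hom-setoid A B) public using (refl; sym; trans)
  open module Reasoning {A B} = SetoidReasoning (hom-setoid A B) public

  infixr 5 refl⟩∘⟨_
  infixl 5 _⟩∘⟨refl

  refl⟩∘⟨_ : ∀ {A B X} {f : B ⇒ X} {g h : A ⇒ B} → g ≈ h → f ∘ g ≈ f ∘ h
  refl⟩∘⟨ p = ∘-resp-≈ refl p

  _⟩∘⟨refl : ∀ {A B X} {f g : B ⇒ X} {h : A ⇒ B} → f ≈ g → f ∘ h ≈ g ∘ h
  p ⟩∘⟨refl = ∘-resp-≈ p refl

  sym-assoc : ∀ {A B X Y} {f : A ⇒ B} {g : B ⇒ X} {h : X ⇒ Y} → h ∘ (g ∘ f) ≈ (h ∘ g) ∘ f
  sym-assoc = sym assoc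

module IsoProperties {o ℓ e} {C : Category o ℓ e} {A B : Category.Obj C} (i : Iso C A B) where
  open Category C
  open HomReasoning C
  open Iso i

  switch-fromto : ∀ {X} {h : X ⇒ A} {k : X ⇒ B} → (from ∘ h ≈ k) ⇔ (h ≈ to ∘ k)
  switch-fromto {h = h} {k} = mk⇔ to-side from-side
    where
      to-side : from ∘ h ≈ k → h ≈ to ∘ k
      to-side p = begin
        h                ≈⟨ sym identityˡ ⟩
        id ∘ h           ≈⟨ sym isoˡ ⟩∘⟨refl ⟩
        (to ∘ from) ∘ h  ≈⟨ assoc ⟩
        to ∘ (from ∘ h)  ≈⟨ refl⟩∘⟨ p ⟩
        to ∘ k           ∎
      from-side : h ≈ to ∘ k → from ∘ h ≈ k
      from-side p = begin
        from ∘ h         ≈⟨ refl⟩∘⟨ p ⟩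
        from ∘ (to ∘ k)  ≈⟨ sym-assoc ⟩
        (from ∘ to) ∘ k  ≈⟨ isoʳ ⟩∘⟨refl ⟩
        id ∘ k           ≈⟨ identityˡ ⟩
        k                ∎

module FunctorProperties {o ℓ e o′ ℓ′ e′} {C : Category o ℓ e} {D : Category o′ ℓ′ e′}
         (F : Functor C D) where
  open HomReasoning D
  open Functor F

  F-resp-Iso : ∀ {A B} → Iso C A B → Iso D (F₀ A) (F₀ B)
  F-resp-Iso i = record
    { from = F₁ from
    ; to   = F₁ to
    ; isoˡ = trans (sym homomorphism) (trans (F-resp-≈ isoˡ) identity)
    ; isoʳ = trans (sym homomorphism) (trans (F-resp-≈ isoʳ) identity)
    }
    where open Iso i

module CoproductProperties {o ℓ e} {C : Category o ℓ e} (CP : BinaryCoproducts C) where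
  open Category C
  open BinaryCoproducts CP
  open HomReasoning C

  ∘-distribˡ-[] : ∀ {A B X Y} {f : A ⇒ X} {g : B ⇒ X} {h : X ⇒ Y} →
                  h ∘ [ f , g ] ≈ [ h ∘ f , h ∘ g ]
  ∘-distribˡ-[] = sym (unique (trans assoc (refl⟩∘⟨ inject₁)) (trans assoc (refl⟩∘⟨ inject₂)))

  []-cong₂ : ∀ {A B X} {f f′ : A ⇒ X} {g g′ : B ⇒ X} → f ≈ f′ → g ≈ g′ → [ f , g ] ≈ [ f′ , g′ ]
  []-cong₂ f≈f′ g≈g′ = sym (unique (trans inject₁ f≈f′) (trans inject₂ g≈g′))

  unique′ : ∀ {A B X} {h h′ : A + B ⇒ X} → h ∘ i₁ ≈ h′ ∘ i₁ → h ∘ i₂ ≈ h′ ∘ i₂ → h ≈ h′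
  unique′ p q = trans (sym (unique refl refl)) (unique (sym p) (sym q))

  []∘+₁ : ∀ {A B A′ B′ X} {f : A′ ⇒ X} {g : B′ ⇒ X} {h : A ⇒ A′} {k : B ⇒ B′} →
          [ f , g ] ∘ (h +₁ k) ≈ [ f ∘ h , g ∘ k ]
  []∘+₁ = trans ∘-distribˡ-[]
                ([]-cong₂ (trans sym-assoc (inject₁ ⟩∘⟨refl)) (trans sym-assoc (inject₂ ⟩∘⟨refl)))

module Transposition {o ℓ e o′ ℓ′ e′} {C : Category o ℓ e} {D : Category o′ ℓ′ e′}
         {F : Functor C D} {G : Functor D C} (adj : Adjunction F G) where
  open Category C
  open HomReasoning C
  private
    module D where
      open Category D public
      open HomReasoning D public
    module F = Functor F
    module G = Functor G
    module unit = NaturalTransformation (Adjunction.unit adj)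
    module counit = NaturalTransformation (Adjunction.counit adj)

  η = unit.η
  ε = counit.η

  ♭ : ∀ {X A} → F.F₀ X D.⇒ A → X ⇒ G.F₀ A
  ♭ {X} k = G.F₁ k ∘ η X

  ♯ : ∀ {X A} → X ⇒ G.F₀ A → F.F₀ X D.⇒ A
  ♯ {A = A} v = ε A D.∘ F.F₁ v

  ♭-resp-≈ : ∀ {X A} {k k′ : F.F₀ X D.⇒ A} → k D.≈ k′ → ♭ k ≈ ♭ k′
  ♭-resp-≈ p = G.F-resp-≈ p ⟩∘⟨refl

  ♭-natural : ∀ {X A B} (u : A D.⇒ B) (k : F.F₀ X D.⇒ A) → ♭ (u D.∘ k) ≈ G.F₁ u ∘ ♭ k
  ♭-natural u k = trans (G.homomorphism ⟩∘⟨refl) assoc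

  ♭-♯ : ∀ {X A} (v : X ⇒ G.F₀ A) → ♭ (♯ v) ≈ v
  ♭-♯ {X} {A} v = begin
    G.F₁ (ε A D.∘ F.F₁ v) ∘ η X              ≈⟨ ♭-natural (ε A) (F.F₁ v) ⟩
    G.F₁ (ε A) ∘ (G.F₁ (F.F₁ v) ∘ η X)       ≈⟨ refl⟩∘⟨ sym (unit.commute v) ⟩
    G.F₁ (ε A) ∘ (η (G.F₀ A) ∘ v)            ≈⟨ sym-assoc ⟩
    (G.F₁ (ε A) ∘ η (G.F₀ A)) ∘ v            ≈⟨ Adjunction.zag adj ⟩∘⟨refl ⟩
    id ∘ v                                   ≈⟨ identityˡ ⟩
    v                                        ∎

  ♯-♭ : ∀ {X A} (k : F.F₀ X D.⇒ A) → ♯ (♭ k) D.≈ k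
  ♯-♭ {X} {A} k = D.begin
    ε A D.∘ F.F₁ (G.F₁ k ∘ η X)                   D.≈⟨ D.refl⟩∘⟨ F.homomorphism ⟩
    ε A D.∘ (F.F₁ (G.F₁ k) D.∘ F.F₁ (η X))        D.≈⟨ D.sym-assoc ⟩
    (ε A D.∘ F.F₁ (G.F₁ k)) D.∘ F.F₁ (η X)        D.≈⟨ counit.commute k D.⟩∘⟨refl ⟩
    (k D.∘ ε (F.F₀ X)) D.∘ F.F₁ (η X)             D.≈⟨ D.assoc ⟩
    k D.∘ (ε (F.F₀ X) D.∘ F.F₁ (η X))             D.≈⟨ D.refl⟩∘⟨ Adjunction.zig adj ⟩
    k D.∘ D.id                                    D.≈⟨ D.identityʳ ⟩
    k                                             D.∎

  ♭-injective : ∀ {X A} {k k′ : F.F₀ X D.⇒ A} → ♭ k ≈ ♭ k′ → k D.≈ k′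
  ♭-injective {k = k} {k′} p =
    D.trans (D.sym (♯-♭ k)) (D.trans (D.∘-resp-≈ D.refl (F.F-resp-≈ p)) (♯-♭ k′))

  transpose-square : ∀ {X A B B′} {k : F.F₀ X D.⇒ A} {u : A D.⇒ B}
                       {v : X ⇒ G.F₀ B′} {w : B′ D.⇒ B} →
                     (u D.∘ k D.≈ w D.∘ ♯ v) ⇔ (G.F₁ u ∘ ♭ k ≈ G.F₁ w ∘ v)
  transpose-square {k = k} {u} {v} {w} = mk⇔ to-side from-side
    where
      ♭-rhs : ♭ (w D.∘ ♯ v) ≈ G.F₁ w ∘ v
      ♭-rhs = trans (♭-natural w (♯ v)) (refl⟩∘⟨ ♭-♯ v)
      to-side : u D.∘ k D.≈ w D.∘ ♯ v → G.F₁ u ∘ ♭ k ≈ G.F₁ w ∘ v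
      to-side p = trans (sym (♭-natural u k)) (trans (♭-resp-≈ p) ♭-rhs)
      from-side : G.F₁ u ∘ ♭ k ≈ G.F₁ w ∘ v → u D.∘ k D.≈ w D.∘ ♯ v
      from-side p = ♭-injective (trans (♭-natural u k) (trans p (sym ♭-rhs)))

module Coalgebras {o ℓ e} {D : Category o ℓ e} (L : Endofunctor D) where
  open Category D
  open HomReasoning D
  module L = Functor L

  IsCoalgebraHom : ∀ {X Y} → X ⇒ L.F₀ X → Y ⇒ L.F₀ Y → X ⇒ Y → Set e
  IsCoalgebraHom a b h = b ∘ h ≈ L.F₁ h ∘ a

  id-hom : ∀ {X} {a : X ⇒ L.F₀ X} → IsCoalgebraHom a a id
  id-hom = trans identityʳ (sym (trans (L.identity ⟩∘⟨refl) identityˡ))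

  ∘-hom : ∀ {X Y Z} {a : X ⇒ L.F₀ X} {b : Y ⇒ L.F₀ Y} {c : Z ⇒ L.F₀ Z} {g : Y ⇒ Z} {h : X ⇒ Y} →
          IsCoalgebraHom b c g → IsCoalgebraHom a b h → IsCoalgebraHom a c (g ∘ h)
  ∘-hom {a = a} {b} {c} {g} {h} g-hom h-hom = begin
    c ∘ (g ∘ h)            ≈⟨ sym-assoc ⟩
    (c ∘ g) ∘ h            ≈⟨ g-hom ⟩∘⟨refl ⟩
    (L.F₁ g ∘ b) ∘ h       ≈⟨ assoc ⟩
    L.F₁ g ∘ (b ∘ h)       ≈⟨ refl⟩∘⟨ h-hom ⟩
    L.F₁ g ∘ (L.F₁ h ∘ a)  ≈⟨ sym-assoc ⟩
    (L.F₁ g ∘ L.F₁ h) ∘ a  ≈⟨ sym L.homomorphism ⟩∘⟨refl ⟩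
    L.F₁ (g ∘ h) ∘ a       ∎

  module _ {Θ} {z : Θ ⇒ L.F₀ Θ} (final : IsFinalCoalgebra D L Θ z) where

    final-unique : ∀ {X} {a : X ⇒ L.F₀ X} {h h′ : X ⇒ Θ} →
                   IsCoalgebraHom a z h → IsCoalgebraHom a z h′ → h ≈ h′
    final-unique {a = a} h-hom h′-hom =
      trans (proj₂ (proj₂ (final a)) _ h-hom) (sym (proj₂ (proj₂ (final a)) _ h′-hom))

    final-endo≈id : ∀ {h : Θ ⇒ Θ} → IsCoalgebraHom z z h → h ≈ id
    final-endo≈id h-hom = final-unique h-hom id-hom

  module CoproductExtension (DP : BinaryCoproducts D) {Θ A} (z : Θ ⇒ L.F₀ Θ)
           (t : A ⇒ L.F₀ (BinaryCoproducts._+_ DP Θ A)) where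
    open BinaryCoproducts DP
    open CoproductProperties DP

    extend : Θ + A ⇒ L.F₀ (Θ + A)
    extend = [ L.F₁ i₁ ∘ z , t ]

    i₁-hom : IsCoalgebraHom z extend i₁
    i₁-hom = inject₁

    hom⇔ : {m : Θ + A ⇒ Θ} → m ∘ i₁ ≈ id →
           IsCoalgebraHom extend z m ⇔ (z ∘ (m ∘ i₂) ≈ L.F₁ m ∘ t)
    hom⇔ {m} m∘i₁≈id = mk⇔ (λ m-hom → trans sym-assoc (trans (m-hom ⟩∘⟨refl) on-i₂))
                            (λ p → unique′ on-i₁ (trans assoc (trans p (sym on-i₂))))
      where
        on-i₂ : (L.F₁ m ∘ extend) ∘ i₂ ≈ L.F₁ m ∘ t
        on-i₂ = trans assoc (refl⟩∘⟨ inject₂)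
        on-i₁ : (z ∘ m) ∘ i₁ ≈ (L.F₁ m ∘ extend) ∘ i₁
        on-i₁ = begin
          (z ∘ m) ∘ i₁              ≈⟨ assoc ⟩
          z ∘ (m ∘ i₁)              ≈⟨ refl⟩∘⟨ m∘i₁≈id ⟩
          z ∘ id                    ≈⟨ id-hom ⟩
          L.F₁ id ∘ z               ≈⟨ L.F-resp-≈ (sym m∘i₁≈id) ⟩∘⟨refl ⟩
          L.F₁ (m ∘ i₁) ∘ z         ≈⟨ L.homomorphism ⟩∘⟨refl ⟩
          (L.F₁ m ∘ L.F₁ i₁) ∘ z    ≈⟨ assoc ⟩
          L.F₁ m ∘ (L.F₁ i₁ ∘ z)    ≈⟨ refl⟩∘⟨ sym inject₁ ⟩
          L.F₁ m ∘ (extend ∘ i₁)    ≈⟨ sym-assoc ⟩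
          (L.F₁ m ∘ extend) ∘ i₁    ∎

module CompleteIteration
    {o ℓ e o′ ℓ′ e′} {C : Category o ℓ e} {D : Category o′ ℓ′ e′}
    (CP : BinaryCoproducts C) (DP : BinaryCoproducts D)
    {F : Functor C D} {G : Functor D C} (adj : Adjunction F G)
    (H : Endofunctor C) (L : Endofunctor D)
    (ρ : NaturalTransformation (H ∘F G) (G ∘F L))
    {Θ : Category.Obj D} (ζ : Iso D Θ (Functor.F₀ L Θ))
    (final : IsFinalCoalgebra D L Θ (Iso.from ζ)) where
  open Category C
  open BinaryCoproducts CP
  open CoproductProperties CP
  open HomReasoning C
  open Transposition adj
  open Coalgebras L
  private
    module D where
      open Category D public
      open HomReasoning D public
    module DP = BinaryCoproducts DP
    module F = Functor F
    module G = Functor G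
    module H = Functor H
    module GL = Functor (G ∘F L)
    module ρ = NaturalTransformation ρ
    z = Iso.from ζ
    Gζ : Iso C (G.F₀ Θ) (G.F₀ (L.F₀ Θ))
    Gζ = FunctorProperties.F-resp-Iso G ζ
    module Gζ = Iso Gζ

  a : H.F₀ (G.F₀ Θ) ⇒ G.F₀ Θ
  a = G.F₁ (Iso.to ζ) ∘ ρ.η Θ

  ρ-♭ : ∀ {X B} (k : F.F₀ X D.⇒ B) → GL.F₁ k ∘ ρ.η (F.F₀ X) ∘ H.F₁ (η X) ≈ ρ.η B ∘ H.F₁ (♭ k)
  ρ-♭ {X} {B} k = begin
    GL.F₁ k ∘ ρ.η (F.F₀ X) ∘ H.F₁ (η X)       ≈⟨ sym-assoc ⟩
    (GL.F₁ k ∘ ρ.η (F.F₀ X)) ∘ H.F₁ (η X)     ≈⟨ sym (ρ.commute k) ⟩∘⟨refl ⟩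
    (ρ.η B ∘ H.F₁ (G.F₁ k)) ∘ H.F₁ (η X)      ≈⟨ assoc ⟩
    ρ.η B ∘ H.F₁ (G.F₁ k) ∘ H.F₁ (η X)        ≈⟨ refl⟩∘⟨ sym H.homomorphism ⟩
    ρ.η B ∘ H.F₁ (♭ k)                        ∎

  module Solve {X} (c : X ⇒ G.F₀ Θ + H.F₀ X) where

    Solution : X ⇒ G.F₀ Θ → Set e
    Solution f = f ≈ [ id , a ] ∘ (id +₁ H.F₁ f) ∘ c

    Unfolds : X ⇒ G.F₀ Θ → Set e
    Unfolds f = G.F₁ z ∘ f ≈ [ G.F₁ z , ρ.η Θ ∘ H.F₁ f ] ∘ c

    solution⇔unfolds : ∀ {f} → Solution f ⇔ Unfolds f
    solution⇔unfolds {f} =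
      mk⇔ (λ s → from (trans s rhs≈)) (λ u → trans (to u) (sym rhs≈))
      where
        open Equivalence (IsoProperties.switch-fromto Gζ)
        rhs≈ : [ id , a ] ∘ (id +₁ H.F₁ f) ∘ c ≈ Gζ.to ∘ [ G.F₁ z , ρ.η Θ ∘ H.F₁ f ] ∘ c
        rhs≈ = begin
          [ id , a ] ∘ (id +₁ H.F₁ f) ∘ c                      ≈⟨ sym-assoc ⟩
          ([ id , a ] ∘ (id +₁ H.F₁ f)) ∘ c                    ≈⟨ []∘+₁ ⟩∘⟨refl ⟩
          [ id ∘ id , a ∘ H.F₁ f ] ∘ c                         ≈⟨ []-cong₂ (trans identityʳ (sym Gζ.isoˡ)) assoc ⟩∘⟨refl ⟩
          [ Gζ.to ∘ G.F₁ z , Gζ.to ∘ ρ.η Θ ∘ H.F₁ f ] ∘ c      ≈⟨ sym ∘-distribˡ-[] ⟩∘⟨refl ⟩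
          (Gζ.to ∘ [ G.F₁ z , ρ.η Θ ∘ H.F₁ f ]) ∘ c            ≈⟨ assoc ⟩
          Gζ.to ∘ [ G.F₁ z , ρ.η Θ ∘ H.F₁ f ] ∘ c              ∎

    unfolds-resp-≈ : ∀ {f f′} → f ≈ f′ → Unfolds f → Unfolds f′
    unfolds-resp-≈ f≈f′ u =
      trans (refl⟩∘⟨ sym f≈f′) (trans u ([]-cong₂ refl (refl⟩∘⟨ H.F-resp-≈ f≈f′) ⟩∘⟨refl))

    step : X ⇒ G.F₀ (L.F₀ (Θ DP.+ F.F₀ X))
    step = [ GL.F₁ DP.i₁ ∘ G.F₁ z , GL.F₁ DP.i₂ ∘ ρ.η (F.F₀ X) ∘ H.F₁ (η X) ] ∘ c

    open CoproductExtension DP z (♯ step)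

    GL∘step : ∀ {m : Θ DP.+ F.F₀ X D.⇒ Θ} → m D.∘ DP.i₁ D.≈ D.id →
               GL.F₁ m ∘ step ≈ [ G.F₁ z , ρ.η Θ ∘ H.F₁ (♭ (m D.∘ DP.i₂)) ] ∘ c
    GL∘step {m} m∘i₁≈id = trans sym-assoc (trans ∘-distribˡ-[] ([]-cong₂ on-Θ on-FX) ⟩∘⟨refl)
      where
        on-Θ : GL.F₁ m ∘ GL.F₁ DP.i₁ ∘ G.F₁ z ≈ G.F₁ z
        on-Θ = begin
          GL.F₁ m ∘ GL.F₁ DP.i₁ ∘ G.F₁ z        ≈⟨ sym-assoc ⟩
          (GL.F₁ m ∘ GL.F₁ DP.i₁) ∘ G.F₁ z      ≈⟨ sym GL.homomorphism ⟩∘⟨refl ⟩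
          GL.F₁ (m D.∘ DP.i₁) ∘ G.F₁ z          ≈⟨ trans (GL.F-resp-≈ m∘i₁≈id) GL.identity ⟩∘⟨refl ⟩
          id ∘ G.F₁ z                           ≈⟨ identityˡ ⟩
          G.F₁ z                                ∎
        on-FX : GL.F₁ m ∘ GL.F₁ DP.i₂ ∘ ρ.η (F.F₀ X) ∘ H.F₁ (η X) ≈ ρ.η Θ ∘ H.F₁ (♭ (m D.∘ DP.i₂))
        on-FX = begin
          GL.F₁ m ∘ GL.F₁ DP.i₂ ∘ ρ.η (F.F₀ X) ∘ H.F₁ (η X)     ≈⟨ sym-assoc ⟩
          (GL.F₁ m ∘ GL.F₁ DP.i₂) ∘ ρ.η (F.F₀ X) ∘ H.F₁ (η X)   ≈⟨ sym GL.homomorphism ⟩∘⟨refl ⟩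
          GL.F₁ (m D.∘ DP.i₂) ∘ ρ.η (F.F₀ X) ∘ H.F₁ (η X)       ≈⟨ ρ-♭ (m D.∘ DP.i₂) ⟩
          ρ.η Θ ∘ H.F₁ (♭ (m D.∘ DP.i₂))                        ∎

    hom⇔unfolds : ∀ {m : Θ DP.+ F.F₀ X D.⇒ Θ} → m D.∘ DP.i₁ D.≈ D.id →
                  IsCoalgebraHom extend z m ⇔ Unfolds (♭ (m D.∘ DP.i₂))
    hom⇔unfolds m∘i₁≈id = mk⇔
      (λ m-hom → trans (to transpose-square (to (hom⇔ m∘i₁≈id) m-hom)) (GL∘step m∘i₁≈id))
      (λ u → from (hom⇔ m∘i₁≈id) (from transpose-square (trans u (sym (GL∘step m∘i₁≈id)))))
      where open Equivalence

    h : Θ DP.+ F.F₀ X D.⇒ Θ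
    h = proj₁ (final extend)

    h-hom : IsCoalgebraHom extend z h
    h-hom = proj₁ (proj₂ (final extend))

    solution : X ⇒ G.F₀ Θ
    solution = ♭ (h D.∘ DP.i₂)

    solution-solves : Solution solution
    solution-solves = Equivalence.from solution⇔unfolds
      (Equivalence.to (hom⇔unfolds (final-endo≈id final (∘-hom h-hom i₁-hom))) h-hom)

    solution-unique : ∀ g → Solution g → g ≈ solution
    solution-unique g g-solves = begin
      g                    ≈⟨ sym ♭[m∘i₂]≈g ⟩
      ♭ (m D.∘ DP.i₂)      ≈⟨ ♭-resp-≈ (final-unique final m-hom h-hom D.⟩∘⟨refl) ⟩
      ♭ (h D.∘ DP.i₂)      ∎
      where
        m : Θ DP.+ F.F₀ X D.⇒ Θ
        m = DP.[ D.id , ♯ g ]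
        ♭[m∘i₂]≈g : ♭ (m D.∘ DP.i₂) ≈ g
        ♭[m∘i₂]≈g = trans (♭-resp-≈ DP.inject₂) (♭-♯ g)
        m-hom : IsCoalgebraHom extend z m
        m-hom = Equivalence.from (hom⇔unfolds DP.inject₁)
          (unfolds-resp-≈ (sym ♭[m∘i₂]≈g) (Equivalence.to solution⇔unfolds g-solves))

theorem8p3 : ∀ {o ℓ e o′ ℓ′ e′} (C : Category o ℓ e) (D : Category o′ ℓ′ e′)
               (CP : BinaryCoproducts C) (DP : BinaryCoproducts D)
               (F : Functor C D) (G : Functor D C) (adj : Adjunction F G)
               (H : Endofunctor C) (L : Endofunctor D)
               (ρ : NaturalTransformation (H ∘F G) (G ∘F L))
               (Θ : Category.Obj D) (ζ : Iso D Θ (Functor.F₀ L Θ)) →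
               IsFinalCoalgebra D L Θ (Iso.from ζ) →
               IsCompletelyIterative C CP H (Functor.F₀ G Θ)
                 (Category._∘_ C (Functor.F₁ G (Iso.to ζ)) (NaturalTransformation.η ρ Θ))
theorem8p3 C D CP DP F G adj H L ρ Θ ζ final c =
  solution , solution-solves , solution-unique
  where open CompleteIteration.Solve CP DP adj H L ρ ζ final c
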